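{- Let $\mathbf{P}=(P;\wedge_p,\vee_p,\neg_p,\bot_p,\top_p)$ and $\mathbf{Q}=(Q;\wedge_q,\vee_q,\neg_q,\bot_q,\top_q)$ be Boolean algebras, let $A$ be a set, and let $r:A\to P$, $e:P\to A$, $r':A\to Q$, $e':Q\to A$ be maps with $r\circ e=\mathrm{id}_P$ and $r'\circ e'=\mathrm{id}_Q$. Define the algebra $\mathbf{A}=(A;\sqcap,\sqcup,\neg,\lrcorner,e'(\top_q),e(\bot_p))$ by $x\sqcap y:=e(r(x)\wedge_p r(y))$, $x\sqcup y:=e'(r'(x)\vee_q r'(y))$, $\neg x:=e(\neg_p r(x))$, $\lrcorner x:=e'(\neg_q r'(x))$. Then $\mathbf{A}$ is a double Boolean algebra if and only if (1) $e\circ r\circ e'\circ r'=e'\circ r'\circ e\circ r$, and (2) for all $x,y\in A$: $e\big(r(x)\wedge_p r(e'(r'(x)\vee_q r'(y)))\big)=e(r(x))$ and $e'\big(r'(x)\vee_q r'(e(r(x)\wedge_p r(y)))\big)=e'(r'(x))$. Moreover, every double Boolean algebra can be obtained from such a construction.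
   Context: For an algebra $(D;\sqcap,\sqcup,\neg,\lrcorner,\top,\bot)$ of type $(2,2,1,1,0,0)$ write $x\vee y:=\neg(\neg x\sqcap\neg y)$ and $x\wedge y:=\lrcorner(\lrcorner x\sqcup\lrcorner y)$. A double Boolean algebra (dBa) is such an algebra satisfying, for all $x,y,z\in D$: $(x\sqcap x)\sqcap y=x\sqcap y$; $(x\sqcup x)\sqcup y=x\sqcup y$; $x\sqcap y=y\sqcap x$; $x\sqcup y=y\sqcup x$; $\neg(x\sqcap x)=\neg x$; $\lrcorner(x\sqcup x)=\lrcorner x$; $x\sqcap(x\sqcup y)=x\sqcap x$; $x\sqcup(x\sqcap y)=x\sqcup x$; $x\sqcap(y\vee z)=(x\sqcap y)\vee(x\sqcap z)$; $x\sqcup(y\wedge z)=(x\sqcup y)\wedge(x\sqcup z)$; $x\sqcap(x\vee y)=x\sqcap x$; $x\sqcup(x\wedge y)=x\sqcup x$; $\neg\neg(x\sqcap y)=x\sqcap y$; $\lrcorner\lrcorner(x\sqcup y)=x\sqcup y$; $x\sqcap\neg x=\bot$; $x\sqcup\lrcorner x=\top$; $\neg\top=\bot$; $\lrcorner\bot=\top$; $x\sqcap(y\sqcap z)=(x\sqcap y)\sqcap z$; $x\sqcup(y\sqcup z)=(x\sqcup y)\sqcup z$; $\neg\bot=\top\sqcap\top$; $\lrcorner\top=\bot\sqcup\bot$; $(x\sqcap x)\sqcup(x\sqcap x)=(x\sqcup x)\sqcap(x\sqcup x)$. -}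

module Defs where

open import Level using (Level; suc) renaming (_⊔_ to _⊔ℓ_)
open import Relation.Binary.PropositionalEquality using (_≡_)
open import Algebra.Lattice.Structures using (IsBooleanAlgebra)
open import Data.Product using (_×_)

record IsDBA {a : Level} {D : Set a}
             (_⊓_ _⊔_ : D → D → D) (¬_ ⌟_ : D → D) (⊤ ⊥ : D) : Set a where
  _∨_ : D → D → D
  x ∨ y = ¬ ((¬ x) ⊓ (¬ y))
  _∧_ : D → D → D
  x ∧ y = ⌟ ((⌟ x) ⊔ (⌟ y))
  field
    ax1a  : ∀ x y → (x ⊓ x) ⊓ y ≡ x ⊓ y
    ax1b  : ∀ x y → (x ⊔ x) ⊔ y ≡ x ⊔ y
    ax2a  : ∀ x y → x ⊓ y ≡ y ⊓ x
    ax2b  : ∀ x y → x ⊔ y ≡ y ⊔ x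
    ax3a  : ∀ x → ¬ (x ⊓ x) ≡ ¬ x
    ax3b  : ∀ x → ⌟ (x ⊔ x) ≡ ⌟ x
    ax4a  : ∀ x y → x ⊓ (x ⊔ y) ≡ x ⊓ x
    ax4b  : ∀ x y → x ⊔ (x ⊓ y) ≡ x ⊔ x
    ax5a  : ∀ x y z → x ⊓ (y ∨ z) ≡ (x ⊓ y) ∨ (x ⊓ z)
    ax5b  : ∀ x y z → x ⊔ (y ∧ z) ≡ (x ⊔ y) ∧ (x ⊔ z)
    ax6a  : ∀ x y → x ⊓ (x ∨ y) ≡ x ⊓ x
    ax6b  : ∀ x y → x ⊔ (x ∧ y) ≡ x ⊔ x
    ax7a  : ∀ x y → ¬ (¬ (x ⊓ y)) ≡ x ⊓ y
    ax7b  : ∀ x y → ⌟ (⌟ (x ⊔ y)) ≡ x ⊔ y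
    ax8a  : ∀ x → x ⊓ (¬ x) ≡ ⊥
    ax8b  : ∀ x → x ⊔ (⌟ x) ≡ ⊤
    ax9a  : ¬ ⊤ ≡ ⊥
    ax9b  : ⌟ ⊥ ≡ ⊤
    ax10a : ∀ x y z → x ⊓ (y ⊓ z) ≡ (x ⊓ y) ⊓ z
    ax10b : ∀ x y z → x ⊔ (y ⊔ z) ≡ (x ⊔ y) ⊔ z
    ax11a : ¬ ⊥ ≡ ⊤ ⊓ ⊤
    ax11b : ⌟ ⊤ ≡ ⊥ ⊔ ⊥
    ax12  : ∀ x → (x ⊓ x) ⊔ (x ⊓ x) ≡ (x ⊔ x) ⊓ (x ⊔ x)

record Setup {a : Level} (A : Set a) (p q : Level) : Set (a ⊔ℓ suc p ⊔ℓ suc q) where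
  field
    P    : Set p
    _∧p_ : P → P → P
    _∨p_ : P → P → P
    ¬p   : P → P
    ⊥p   : P
    ⊤p   : P
    isBAP : IsBooleanAlgebra _≡_ _∨p_ _∧p_ ¬p ⊤p ⊥p
    Q    : Set q
    _∧q_ : Q → Q → Q
    _∨q_ : Q → Q → Q
    ¬q   : Q → Q
    ⊥q   : Q
    ⊤q   : Q
    isBAQ : IsBooleanAlgebra _≡_ _∨q_ _∧q_ ¬q ⊤q ⊥q
    r  : A → P
    e  : P → A
    r' : A → Q
    e' : Q → A
    re  : ∀ x → r (e x) ≡ x
    re' : ∀ x → r' (e' x) ≡ x

  _⊓_ : A → A → A
  x ⊓ y = e (r x ∧p r y)
  _⊔_ : A → A → A
  x ⊔ y = e' (r' x ∨q r' y)
  ¬A : A → A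
  ¬A x = e (¬p (r x))
  ⌟A : A → A
  ⌟A x = e' (¬q (r' x))
  ⊤A : A
  ⊤A = e' ⊤q
  ⊥A : A
  ⊥A = e ⊥p

  Cond1 : Set a
  Cond1 = ∀ x → e (r (e' (r' x))) ≡ e' (r' (e (r x)))

  Cond2 : Set a
  Cond2 = ∀ x y → (e (r x ∧p r (e' (r' x ∨q r' y))) ≡ e (r x))
                × (e' (r' x ∨q r' (e (r x ∧p r y))) ≡ e' (r' x))

  IsDBAConstructed : Set a
  IsDBAConstructed = IsDBA _⊓_ _⊔_ ¬A ⌟A ⊤A ⊥A

{-# OPTIONS --safe #-}
-- The dBa axioms split into a ⊓-half (1a)–(11a), the dual ⊔-half (1b)–(11b)
-- and the linking axiom (12).  In the construction r is injective on the
-- image of e, so the ⊓-half reduces to Boolean identities in P, except that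
-- (4a) is literally the first half of condition (2) (which also forces
-- r (e' ⊤q) = ⊤p); since x ⊓ x = e (r x) and x ⊔ x = e' (r' x), axiom (12)
-- is condition (1).  Conversely, in a dBa the ⊓-idempotents form a Boolean
-- algebra under ⊓ and ¬, and likewise the ⊔-idempotents under ⊔ and ⌟;
-- x ↦ x ⊓ x and x ↦ x ⊔ x are retractions onto them that recover the
-- operations.
module Submission where

open import Defs
open import Level using (Level)
open import Relation.Binary.PropositionalEquality
  using (_≡_; refl; sym; trans; cong; cong₂; isEquivalence; module ≡-Reasoning)
open import Data.Product using (Σ; _×_; _,_; proj₁; proj₂)
open import Function.Bundles using (_⇔_; mk⇔; Equivalence)
open import Algebra.Lattice.Structures using (IsBooleanAlgebra)
open import Algebra.Lattice.Bundles using (BooleanAlgebra)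
import Algebra.Lattice.Properties.BooleanAlgebra as BooleanAlgebraProperties
open import Algebra.Consequences.Propositional using (comm∧distrˡ⇒distr; comm∧invʳ⇒inv)
open import Axiom.UniquenessOfIdentityProofs.WithK using (uip)

-- Axioms (1a)–(11a) of a double Boolean algebra; (1b)–(11b) are the same
-- axioms for the signature (⊔, ⊓, ⌟, ⊤, ⊥).
record IsHalfDBA {a : Level} {D : Set a}
                 (_⊓_ _⊔_ : D → D → D) (¬_ : D → D) (⊥ ⊤ : D) : Set a where
  _∨_ : D → D → D
  x ∨ y = ¬ ((¬ x) ⊓ (¬ y))
  field
    ax1  : ∀ x y → (x ⊓ x) ⊓ y ≡ x ⊓ y
    ax2  : ∀ x y → x ⊓ y ≡ y ⊓ x
    ax3  : ∀ x → ¬ (x ⊓ x) ≡ ¬ x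
    ax4  : ∀ x y → x ⊓ (x ⊔ y) ≡ x ⊓ x
    ax5  : ∀ x y z → x ⊓ (y ∨ z) ≡ (x ⊓ y) ∨ (x ⊓ z)
    ax6  : ∀ x y → x ⊓ (x ∨ y) ≡ x ⊓ x
    ax7  : ∀ x y → ¬ (¬ (x ⊓ y)) ≡ x ⊓ y
    ax8  : ∀ x → x ⊓ (¬ x) ≡ ⊥
    ax9  : ¬ ⊤ ≡ ⊥
    ax10 : ∀ x y z → x ⊓ (y ⊓ z) ≡ (x ⊓ y) ⊓ z
    ax11 : ¬ ⊥ ≡ ⊤ ⊓ ⊤

module _ {a : Level} {D : Set a} {_⊓_ _⊔_ : D → D → D} {¬_ ⌟_ : D → D} {⊤ ⊥ : D} where

  meetHalf : IsDBA _⊓_ _⊔_ ¬_ ⌟_ ⊤ ⊥ → IsHalfDBA _⊓_ _⊔_ ¬_ ⊥ ⊤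
  meetHalf d = record
    { ax1 = ax1a ; ax2 = ax2a ; ax3 = ax3a ; ax4 = ax4a ; ax5 = ax5a ; ax6 = ax6a
    ; ax7 = ax7a ; ax8 = ax8a ; ax9 = ax9a ; ax10 = ax10a ; ax11 = ax11a }
    where open IsDBA d

  joinHalf : IsDBA _⊓_ _⊔_ ¬_ ⌟_ ⊤ ⊥ → IsHalfDBA _⊔_ _⊓_ ⌟_ ⊤ ⊥
  joinHalf d = record
    { ax1 = ax1b ; ax2 = ax2b ; ax3 = ax3b ; ax4 = ax4b ; ax5 = ax5b ; ax6 = ax6b
    ; ax7 = ax7b ; ax8 = ax8b ; ax9 = ax9b ; ax10 = ax10b ; ax11 = ax11b }
    where open IsDBA d

  fromHalves : IsHalfDBA _⊓_ _⊔_ ¬_ ⊥ ⊤ → IsHalfDBA _⊔_ _⊓_ ⌟_ ⊤ ⊥ →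
               (∀ x → (x ⊓ x) ⊔ (x ⊓ x) ≡ (x ⊔ x) ⊓ (x ⊔ x)) →
               IsDBA _⊓_ _⊔_ ¬_ ⌟_ ⊤ ⊥
  fromHalves m j ax12 = record
    { ax1a = M.ax1 ; ax2a = M.ax2 ; ax3a = M.ax3 ; ax4a = M.ax4 ; ax5a = M.ax5
    ; ax6a = M.ax6 ; ax7a = M.ax7 ; ax8a = M.ax8 ; ax9a = M.ax9 ; ax10a = M.ax10
    ; ax11a = M.ax11
    ; ax1b = J.ax1 ; ax2b = J.ax2 ; ax3b = J.ax3 ; ax4b = J.ax4 ; ax5b = J.ax5
    ; ax6b = J.ax6 ; ax7b = J.ax7 ; ax8b = J.ax8 ; ax9b = J.ax9 ; ax10b = J.ax10
    ; ax11b = J.ax11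
    ; ax12 = ax12 }
    where
    module M = IsHalfDBA m
    module J = IsHalfDBA j

module Idempotents {a : Level} {D : Set a} {_⊓_ _⊔_ : D → D → D} {¬_ : D → D} {⊥ ⊤ : D}
                   (H : IsHalfDBA _⊓_ _⊔_ ¬_ ⊥ ⊤) where
  open IsHalfDBA H
  open ≡-Reasoning

  ⊓-idem-on-⊓ : ∀ x y → (x ⊓ y) ⊓ (x ⊓ y) ≡ x ⊓ y
  ⊓-idem-on-⊓ x y = begin
    (x ⊓ y) ⊓ (x ⊓ y)  ≡⟨ ax10 (x ⊓ y) x y ⟩
    ((x ⊓ y) ⊓ x) ⊓ y  ≡⟨ cong (_⊓ y) (ax2 (x ⊓ y) x) ⟩
    (x ⊓ (x ⊓ y)) ⊓ y  ≡⟨ cong (_⊓ y) (ax10 x x y) ⟩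
    ((x ⊓ x) ⊓ y) ⊓ y  ≡⟨ cong (_⊓ y) (ax1 x y) ⟩
    (x ⊓ y) ⊓ y        ≡⟨ sym (ax10 x y y) ⟩
    x ⊓ (y ⊓ y)        ≡⟨ ax2 x (y ⊓ y) ⟩
    (y ⊓ y) ⊓ x        ≡⟨ ax1 y x ⟩
    y ⊓ x              ≡⟨ ax2 y x ⟩
    x ⊓ y              ∎

  ¬¬≡square : ∀ x → ¬ ¬ x ≡ x ⊓ x
  ¬¬≡square x = trans (cong ¬_ (sym (ax3 x))) (ax7 x x)

  ⊓-idem-on-¬ : ∀ x → (¬ x) ⊓ (¬ x) ≡ ¬ x
  ⊓-idem-on-¬ x = begin
    (¬ x) ⊓ (¬ x)      ≡⟨ sym (ax7 (¬ x) (¬ x)) ⟩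
    ¬ ¬ ((¬ x) ⊓ (¬ x)) ≡⟨ cong ¬_ (ax3 (¬ x)) ⟩
    ¬ ¬ ¬ x            ≡⟨ cong ¬_ (¬¬≡square x) ⟩
    ¬ (x ⊓ x)          ≡⟨ ax3 x ⟩
    ¬ x                ∎

  ⊓-idem-on-⊥ : ⊥ ⊓ ⊥ ≡ ⊥
  ⊓-idem-on-⊥ = begin
    ⊥ ⊓ ⊥                  ≡⟨ cong₂ _⊓_ (sym (ax8 ⊥)) (sym (ax8 ⊥)) ⟩
    (⊥ ⊓ (¬ ⊥)) ⊓ (⊥ ⊓ (¬ ⊥)) ≡⟨ ⊓-idem-on-⊓ ⊥ (¬ ⊥) ⟩
    ⊥ ⊓ (¬ ⊥)              ≡⟨ ax8 ⊥ ⟩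
    ⊥                      ∎

  ⊓-squares : ∀ x y → x ⊓ y ≡ (x ⊓ x) ⊓ (y ⊓ y)
  ⊓-squares x y = sym (begin
    (x ⊓ x) ⊓ (y ⊓ y)  ≡⟨ ax1 x (y ⊓ y) ⟩
    x ⊓ (y ⊓ y)        ≡⟨ ax2 x (y ⊓ y) ⟩
    (y ⊓ y) ⊓ x        ≡⟨ ax1 y x ⟩
    y ⊓ x              ≡⟨ ax2 y x ⟩
    x ⊓ y              ∎)

  Idem : Set a
  Idem = Σ D λ x → x ⊓ x ≡ x

  Idem-≡ : {u v : Idem} → proj₁ u ≡ proj₁ v → u ≡ v
  Idem-≡ {x , p} {.x , q} refl = cong (x ,_) (uip p q)

  square : D → Idem
  square x = x ⊓ x , ⊓-idem-on-⊓ x x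

  square-proj₁ : ∀ u → square (proj₁ u) ≡ u
  square-proj₁ (x , x⊓x≡x) = Idem-≡ x⊓x≡x

  infixr 7 _∧ᵢ_
  infixr 6 _∨ᵢ_

  _∧ᵢ_ : Idem → Idem → Idem
  (x , _) ∧ᵢ (y , _) = x ⊓ y , ⊓-idem-on-⊓ x y

  ¬ᵢ : Idem → Idem
  ¬ᵢ (x , _) = ¬ x , ⊓-idem-on-¬ x

  _∨ᵢ_ : Idem → Idem → Idem
  u ∨ᵢ v = ¬ᵢ (¬ᵢ u ∧ᵢ ¬ᵢ v)

  ⊥ᵢ : Idem
  ⊥ᵢ = ⊥ , ⊓-idem-on-⊥

  ⊤ᵢ : Idem
  ⊤ᵢ = ¬ᵢ ⊥ᵢ

  ¬ᵢ-involutive : ∀ u → ¬ᵢ (¬ᵢ u) ≡ u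
  ¬ᵢ-involutive (x , x⊓x≡x) = Idem-≡ (trans (¬¬≡square x) x⊓x≡x)

  ∧ᵢ-comm : ∀ u v → u ∧ᵢ v ≡ v ∧ᵢ u
  ∧ᵢ-comm (x , _) (y , _) = Idem-≡ (ax2 x y)

  ∧ᵢ-assoc : ∀ u v w → (u ∧ᵢ v) ∧ᵢ w ≡ u ∧ᵢ (v ∧ᵢ w)
  ∧ᵢ-assoc (x , _) (y , _) (z , _) = Idem-≡ (sym (ax10 x y z))

  ∧ᵢ-absorbs-∨ᵢ : ∀ u v → u ∧ᵢ (u ∨ᵢ v) ≡ u
  ∧ᵢ-absorbs-∨ᵢ (x , x⊓x≡x) (y , _) = Idem-≡ (trans (ax6 x y) x⊓x≡x)

  ∧ᵢ-distribˡ-∨ᵢ : ∀ u v w → u ∧ᵢ (v ∨ᵢ w) ≡ (u ∧ᵢ v) ∨ᵢ (u ∧ᵢ w)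
  ∧ᵢ-distribˡ-∨ᵢ (x , _) (y , _) (z , _) = Idem-≡ (ax5 x y z)

  ∧ᵢ-complementʳ : ∀ u → u ∧ᵢ ¬ᵢ u ≡ ⊥ᵢ
  ∧ᵢ-complementʳ (x , _) = Idem-≡ (ax8 x)

  -- Since ¬ᵢ is an involution, ¬ᵢ maps ∧ᵢ to ∨ᵢ and back, so every law
  -- for ∨ᵢ is the ¬ᵢ-image of the corresponding law for ∧ᵢ.
  ¬ᵢ-∨ᵢ : ∀ u v → ¬ᵢ (u ∨ᵢ v) ≡ ¬ᵢ u ∧ᵢ ¬ᵢ v
  ¬ᵢ-∨ᵢ u v = ¬ᵢ-involutive (¬ᵢ u ∧ᵢ ¬ᵢ v)

  ¬ᵢ-∧ᵢ : ∀ u v → ¬ᵢ (u ∧ᵢ v) ≡ ¬ᵢ u ∨ᵢ ¬ᵢ v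
  ¬ᵢ-∧ᵢ u v = cong ¬ᵢ (sym (cong₂ _∧ᵢ_ (¬ᵢ-involutive u) (¬ᵢ-involutive v)))

  ∨ᵢ-comm : ∀ u v → u ∨ᵢ v ≡ v ∨ᵢ u
  ∨ᵢ-comm u v = cong ¬ᵢ (∧ᵢ-comm (¬ᵢ u) (¬ᵢ v))

  ∨ᵢ-assoc : ∀ u v w → (u ∨ᵢ v) ∨ᵢ w ≡ u ∨ᵢ (v ∨ᵢ w)
  ∨ᵢ-assoc u v w = cong ¬ᵢ (begin
    ¬ᵢ (u ∨ᵢ v) ∧ᵢ ¬ᵢ w        ≡⟨ cong (_∧ᵢ ¬ᵢ w) (¬ᵢ-∨ᵢ u v) ⟩
    (¬ᵢ u ∧ᵢ ¬ᵢ v) ∧ᵢ ¬ᵢ w     ≡⟨ ∧ᵢ-assoc (¬ᵢ u) (¬ᵢ v) (¬ᵢ w) ⟩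
    ¬ᵢ u ∧ᵢ (¬ᵢ v ∧ᵢ ¬ᵢ w)     ≡⟨ cong (¬ᵢ u ∧ᵢ_) (sym (¬ᵢ-∨ᵢ v w)) ⟩
    ¬ᵢ u ∧ᵢ ¬ᵢ (v ∨ᵢ w)        ∎)

  ∨ᵢ-absorbs-∧ᵢ : ∀ u v → u ∨ᵢ (u ∧ᵢ v) ≡ u
  ∨ᵢ-absorbs-∧ᵢ u v = begin
    ¬ᵢ (¬ᵢ u ∧ᵢ ¬ᵢ (u ∧ᵢ v))        ≡⟨ cong (λ t → ¬ᵢ (¬ᵢ u ∧ᵢ t)) (¬ᵢ-∧ᵢ u v) ⟩
    ¬ᵢ (¬ᵢ u ∧ᵢ (¬ᵢ u ∨ᵢ ¬ᵢ v))     ≡⟨ cong ¬ᵢ (∧ᵢ-absorbs-∨ᵢ (¬ᵢ u) (¬ᵢ v)) ⟩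
    ¬ᵢ (¬ᵢ u)                      ≡⟨ ¬ᵢ-involutive u ⟩
    u                              ∎

  ∨ᵢ-distribˡ-∧ᵢ : ∀ u v w → u ∨ᵢ (v ∧ᵢ w) ≡ (u ∨ᵢ v) ∧ᵢ (u ∨ᵢ w)
  ∨ᵢ-distribˡ-∧ᵢ u v w = begin
    ¬ᵢ (¬ᵢ u ∧ᵢ ¬ᵢ (v ∧ᵢ w))                        ≡⟨ cong (λ t → ¬ᵢ (¬ᵢ u ∧ᵢ t)) (¬ᵢ-∧ᵢ v w) ⟩
    ¬ᵢ (¬ᵢ u ∧ᵢ (¬ᵢ v ∨ᵢ ¬ᵢ w))                     ≡⟨ cong ¬ᵢ (∧ᵢ-distribˡ-∨ᵢ (¬ᵢ u) (¬ᵢ v) (¬ᵢ w)) ⟩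
    ¬ᵢ ((¬ᵢ u ∧ᵢ ¬ᵢ v) ∨ᵢ (¬ᵢ u ∧ᵢ ¬ᵢ w))           ≡⟨ ¬ᵢ-∨ᵢ (¬ᵢ u ∧ᵢ ¬ᵢ v) (¬ᵢ u ∧ᵢ ¬ᵢ w) ⟩
    (u ∨ᵢ v) ∧ᵢ (u ∨ᵢ w)                            ∎

  ∨ᵢ-complementʳ : ∀ u → u ∨ᵢ ¬ᵢ u ≡ ⊤ᵢ
  ∨ᵢ-complementʳ u = cong ¬ᵢ (begin
    ¬ᵢ u ∧ᵢ ¬ᵢ (¬ᵢ u)  ≡⟨ cong (¬ᵢ u ∧ᵢ_) (¬ᵢ-involutive u) ⟩
    ¬ᵢ u ∧ᵢ u          ≡⟨ ∧ᵢ-comm (¬ᵢ u) u ⟩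
    u ∧ᵢ ¬ᵢ u          ≡⟨ ∧ᵢ-complementʳ u ⟩
    ⊥ᵢ                 ∎)

  isBooleanAlgebra : IsBooleanAlgebra _≡_ _∨ᵢ_ _∧ᵢ_ ¬ᵢ ⊤ᵢ ⊥ᵢ
  isBooleanAlgebra = record
    { isDistributiveLattice = record
      { isLattice = record
        { isEquivalence = isEquivalence
        ; ∨-comm        = ∨ᵢ-comm
        ; ∨-assoc       = ∨ᵢ-assoc
        ; ∨-cong        = cong₂ _∨ᵢ_
        ; ∧-comm        = ∧ᵢ-comm
        ; ∧-assoc       = ∧ᵢ-assoc
        ; ∧-cong        = cong₂ _∧ᵢ_
        ; absorptive    = ∨ᵢ-absorbs-∧ᵢ , ∧ᵢ-absorbs-∨ᵢ
        }
      ; ∨-distrib-∧ = comm∧distrˡ⇒distr (cong₂ _∧ᵢ_) ∨ᵢ-comm ∨ᵢ-distribˡ-∧ᵢ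
      ; ∧-distrib-∨ = comm∧distrˡ⇒distr (cong₂ _∨ᵢ_) ∧ᵢ-comm ∧ᵢ-distribˡ-∨ᵢ
      }
    ; ∨-complement = comm∧invʳ⇒inv {_⁻¹ = ¬ᵢ} ∨ᵢ-comm ∨ᵢ-complementʳ
    ; ∧-complement = comm∧invʳ⇒inv {_⁻¹ = ¬ᵢ} ∧ᵢ-comm ∧ᵢ-complementʳ
    ; ¬-cong       = cong ¬ᵢ
    }

  booleanAlgebra : BooleanAlgebra a a
  booleanAlgebra = record { isBooleanAlgebra = isBooleanAlgebra }

-- Exchanging P and Q and turning both upside down exchanges ⊓ with ⊔, ¬A
-- with ⌟A and ⊤A with ⊥A, so every statement about the ⊓-half of the
-- construction also holds for its ⊔-half.
dual : ∀ {a p q : Level} {A : Set a} → Setup A p q → Setup A q p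
dual S = record
  { P = Q ; _∧p_ = _∨q_ ; _∨p_ = _∧q_ ; ¬p = ¬q ; ⊥p = ⊤q ; ⊤p = ⊥q
  ; isBAP = BooleanAlgebraProperties.∧-∨-isBooleanAlgebra (record { isBooleanAlgebra = isBAQ })
  ; Q = P ; _∧q_ = _∨p_ ; _∨q_ = _∧p_ ; ¬q = ¬p ; ⊥q = ⊤p ; ⊤q = ⊥p
  ; isBAQ = BooleanAlgebraProperties.∧-∨-isBooleanAlgebra (record { isBooleanAlgebra = isBAP })
  ; r = r' ; e = e' ; r' = r ; e' = e ; re = re' ; re' = re
  }
  where open Setup S

module Construction {a p q : Level} {A : Set a} (S : Setup A p q) where
  open Setup S
  open ≡-Reasoning

  private
    module P where
      Pᴮ : BooleanAlgebra p p
      Pᴮ = record { isBooleanAlgebra = isBAP }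
      open BooleanAlgebra Pᴮ public
      open BooleanAlgebraProperties Pᴮ public
    module Q where
      Qᴮ : BooleanAlgebra q q
      Qᴮ = record { isBooleanAlgebra = isBAQ }
      open BooleanAlgebra Qᴮ public
      open BooleanAlgebraProperties Qᴮ public

  _∨_ : A → A → A
  x ∨ y = ¬A (¬A x ⊓ ¬A y)

  Absorptive : Set a
  Absorptive = ∀ x y → e (r x ∧p r (x ⊔ y)) ≡ e (r x)

  e-injective : ∀ {u v} → e u ≡ e v → u ≡ v
  e-injective {u} {v} eu≡ev = trans (sym (re u)) (trans (cong r eu≡ev) (re v))

  -- Terms built from ⊓, ¬A and ⊥A lie in the image of e, on which r is
  -- injective; so the ⊓-axioms are identities in P between their r-images.
  ≡-by-r : ∀ {u v} → r (e u) ≡ r (e v) → e u ≡ e v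
  ≡-by-r eq = cong e (trans (sym (re _)) (trans eq (re _)))

  r-⊓ : ∀ x y → r (x ⊓ y) ≡ r x ∧p r y
  r-⊓ x y = re (r x ∧p r y)

  r-¬A : ∀ x → r (¬A x) ≡ ¬p (r x)
  r-¬A x = re (¬p (r x))

  r-⊥A : r ⊥A ≡ ⊥p
  r-⊥A = re ⊥p

  r-∨ : ∀ x y → r (x ∨ y) ≡ r x ∨p r y
  r-∨ x y = begin
    r (¬A (¬A x ⊓ ¬A y))              ≡⟨ r-¬A (¬A x ⊓ ¬A y) ⟩
    ¬p (r (¬A x ⊓ ¬A y))              ≡⟨ cong ¬p (r-⊓ (¬A x) (¬A y)) ⟩
    ¬p (r (¬A x) ∧p r (¬A y))         ≡⟨ cong ¬p (cong₂ _∧p_ (r-¬A x) (r-¬A y)) ⟩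
    ¬p (¬p (r x) ∧p ¬p (r y))         ≡⟨ P.deMorgan₁ (¬p (r x)) (¬p (r y)) ⟩
    ¬p (¬p (r x)) ∨p ¬p (¬p (r y))    ≡⟨ cong₂ _∨p_ (P.¬-involutive (r x)) (P.¬-involutive (r y)) ⟩
    r x ∨p r y                        ∎

  r-⊓-diagonal : ∀ x → r (x ⊓ x) ≡ r x
  r-⊓-diagonal x = trans (r-⊓ x x) (P.∧-idem (r x))

  ⊓-diagonal : ∀ x → x ⊓ x ≡ e (r x)
  ⊓-diagonal x = cong e (P.∧-idem (r x))

  ⊔-diagonal : ∀ x → x ⊔ x ≡ e' (r' x)
  ⊔-diagonal x = cong e' (Q.∨-idem (r' x))

  ⊔-⊤A : ∀ x → x ⊔ ⊤A ≡ ⊤A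
  ⊔-⊤A x = cong e' (trans (cong (r' x ∨q_) (re' ⊤q)) (Q.∨-zeroʳ (r' x)))

  absorptive⇔ax4 : Absorptive ⇔ (∀ x y → x ⊓ (x ⊔ y) ≡ x ⊓ x)
  absorptive⇔ax4 = mk⇔
    (λ absorptive x y → trans (absorptive x y) (sym (⊓-diagonal x)))
    (λ ax4 x y → trans (ax4 x y) (⊓-diagonal x))

  r-⊤A : Absorptive → r ⊤A ≡ ⊤p
  r-⊤A absorptive = e-injective (begin
    e (r ⊤A)                        ≡⟨ cong e (sym (P.∧-identityˡ (r ⊤A))) ⟩
    e (⊤p ∧p r ⊤A)                  ≡⟨ cong₂ (λ s t → e (s ∧p r t)) (sym (re ⊤p)) (sym (⊔-⊤A (e ⊤p))) ⟩
    e (r (e ⊤p) ∧p r (e ⊤p ⊔ ⊤A))   ≡⟨ absorptive (e ⊤p) ⊤A ⟩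
    e (r (e ⊤p))                    ≡⟨ cong e (re ⊤p) ⟩
    e ⊤p                            ∎)

  meetHalf-of-absorptive : Absorptive → IsHalfDBA _⊓_ _⊔_ ¬A ⊥A ⊤A
  meetHalf-of-absorptive absorptive = record
    { ax1  = λ x y → cong (λ t → e (t ∧p r y)) (r-⊓-diagonal x)
    ; ax2  = λ x y → cong e (P.∧-comm (r x) (r y))
    ; ax3  = λ x → cong (λ t → e (¬p t)) (r-⊓-diagonal x)
    ; ax4  = Equivalence.to absorptive⇔ax4 absorptive
    ; ax5  = λ x y z → ≡-by-r (begin
        r (x ⊓ (y ∨ z))                 ≡⟨ r-⊓ x (y ∨ z) ⟩
        r x ∧p r (y ∨ z)                ≡⟨ cong (r x ∧p_) (r-∨ y z) ⟩
        r x ∧p (r y ∨p r z)             ≡⟨ P.∧-distribˡ-∨ (r x) (r y) (r z) ⟩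
        (r x ∧p r y) ∨p (r x ∧p r z)    ≡⟨ sym (cong₂ _∨p_ (r-⊓ x y) (r-⊓ x z)) ⟩
        r (x ⊓ y) ∨p r (x ⊓ z)          ≡⟨ sym (r-∨ (x ⊓ y) (x ⊓ z)) ⟩
        r ((x ⊓ y) ∨ (x ⊓ z))           ∎)
    ; ax6  = λ x y → cong e (begin
        r x ∧p r (x ∨ y)                ≡⟨ cong (r x ∧p_) (r-∨ x y) ⟩
        r x ∧p (r x ∨p r y)             ≡⟨ P.∧-absorbs-∨ (r x) (r y) ⟩
        r x                             ≡⟨ sym (P.∧-idem (r x)) ⟩
        r x ∧p r x                      ∎)
    ; ax7  = λ x y → ≡-by-r (begin
        r (¬A (¬A (x ⊓ y)))             ≡⟨ r-¬A (¬A (x ⊓ y)) ⟩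
        ¬p (r (¬A (x ⊓ y)))             ≡⟨ cong ¬p (r-¬A (x ⊓ y)) ⟩
        ¬p (¬p (r (x ⊓ y)))             ≡⟨ P.¬-involutive (r (x ⊓ y)) ⟩
        r (x ⊓ y)                       ∎)
    ; ax8  = λ x → cong e (trans (cong (r x ∧p_) (r-¬A x)) (P.∧-complementʳ (r x)))
    ; ax9  = cong e (trans (cong ¬p (r-⊤A absorptive)) P.¬⊤≈⊥)
    ; ax10 = λ x y z → cong e (begin
        r x ∧p r (y ⊓ z)                ≡⟨ cong (r x ∧p_) (r-⊓ y z) ⟩
        r x ∧p (r y ∧p r z)             ≡⟨ sym (P.∧-assoc (r x) (r y) (r z)) ⟩
        (r x ∧p r y) ∧p r z             ≡⟨ cong (_∧p r z) (sym (r-⊓ x y)) ⟩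
        r (x ⊓ y) ∧p r z                ∎)
    ; ax11 = cong e (begin
        ¬p (r ⊥A)                       ≡⟨ cong ¬p r-⊥A ⟩
        ¬p ⊥p                           ≡⟨ P.¬⊥≈⊤ ⟩
        ⊤p                              ≡⟨ sym (P.∧-idem ⊤p) ⟩
        ⊤p ∧p ⊤p                        ≡⟨ sym (cong₂ _∧p_ (r-⊤A absorptive) (r-⊤A absorptive)) ⟩
        r ⊤A ∧p r ⊤A                    ∎)
    }

  ⊓⊔-squares : ∀ x → (x ⊓ x) ⊔ (x ⊓ x) ≡ e' (r' (e (r x)))
  ⊓⊔-squares x = trans (⊔-diagonal (x ⊓ x)) (cong (λ t → e' (r' t)) (⊓-diagonal x))

  ⊔⊓-squares : ∀ x → (x ⊔ x) ⊓ (x ⊔ x) ≡ e (r (e' (r' x)))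
  ⊔⊓-squares x = trans (⊓-diagonal (x ⊔ x)) (cong (λ t → e (r t)) (⊔-diagonal x))

  cond1⇔ax12 : Cond1 ⇔ (∀ x → (x ⊓ x) ⊔ (x ⊓ x) ≡ (x ⊔ x) ⊓ (x ⊔ x))
  cond1⇔ax12 = mk⇔
    (λ cond1 x → trans (⊓⊔-squares x) (trans (sym (cond1 x)) (sym (⊔⊓-squares x))))
    (λ ax12 x → trans (sym (⊔⊓-squares x)) (trans (sym (ax12 x)) (⊓⊔-squares x)))

dba⇔conditions : ∀ {a p q : Level} {A : Set a} (S : Setup A p q) →
                 Setup.IsDBAConstructed S ⇔ (Setup.Cond1 S × Setup.Cond2 S)
dba⇔conditions S = mk⇔
  (λ d → from S.cond1⇔ax12 (IsDBA.ax12 d)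
       , λ x y → from S.absorptive⇔ax4 (IsDBA.ax4a d) x y
               , from Sᵒ.absorptive⇔ax4 (IsDBA.ax4b d) x y)
  (λ (cond1 , cond2) → fromHalves
     (S.meetHalf-of-absorptive (λ x y → proj₁ (cond2 x y)))
     (Sᵒ.meetHalf-of-absorptive (λ x y → proj₂ (cond2 x y)))
     (to S.cond1⇔ax12 cond1))
  where
  open Equivalence
  module S  = Construction S
  module Sᵒ = Construction (dual S)

-- ⊔ is the meet of J.booleanAlgebra, so Q is that algebra upside down.
canonicalSetup : ∀ {a : Level} {D : Set a} {_⊓_ _⊔_ : D → D → D} {¬_ ⌟_ : D → D} {⊤ ⊥ : D} →
                 IsDBA _⊓_ _⊔_ ¬_ ⌟_ ⊤ ⊥ → Setup D a a
canonicalSetup d = record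
  { P = M.Idem ; _∧p_ = M._∧ᵢ_ ; _∨p_ = M._∨ᵢ_ ; ¬p = M.¬ᵢ ; ⊥p = M.⊥ᵢ ; ⊤p = M.⊤ᵢ
  ; isBAP = M.isBooleanAlgebra
  ; Q = J.Idem ; _∧q_ = J._∨ᵢ_ ; _∨q_ = J._∧ᵢ_ ; ¬q = J.¬ᵢ ; ⊥q = J.⊤ᵢ ; ⊤q = J.⊥ᵢ
  ; isBAQ = BooleanAlgebraProperties.∧-∨-isBooleanAlgebra J.booleanAlgebra
  ; r = M.square ; e = proj₁ ; r' = J.square ; e' = proj₁
  ; re = M.square-proj₁ ; re' = J.square-proj₁
  }
  where
  module M = Idempotents (meetHalf d)
  module J = Idempotents (joinHalf d)

theorem4p1 : ∀ {a p q : Level}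
               → ((A : Set a) (S : Setup A p q)
                  → Setup.IsDBAConstructed S ⇔ (Setup.Cond1 S × Setup.Cond2 S))
               × ((D : Set a) (_⊓_ _⊔_ : D → D → D) (¬_ ⌟_ : D → D) (⊤ ⊥ : D)
                  → IsDBA _⊓_ _⊔_ ¬_ ⌟_ ⊤ ⊥
                  → Σ (Setup D a a) λ S
                      → (∀ x y → x ⊓ y ≡ Setup._⊓_ S x y)
                      × (∀ x y → x ⊔ y ≡ Setup._⊔_ S x y)
                      × (∀ x → ¬ x ≡ Setup.¬A S x)
                      × (∀ x → ⌟ x ≡ Setup.⌟A S x)
                      × (⊤ ≡ Setup.⊤A S)
                      × (⊥ ≡ Setup.⊥A S))
theorem4p1 =
    (λ A → dba⇔conditions)
  , λ D _⊓_ _⊔_ ¬_ ⌟_ ⊤ ⊥ d →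
        canonicalSetup d
      , Idempotents.⊓-squares (meetHalf d)
      , Idempotents.⊓-squares (joinHalf d)
      , (λ x → sym (IsDBA.ax3a d x))
      , (λ x → sym (IsDBA.ax3b d x))
      , refl
      , refl
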